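{- Let $r$, $m$, $n$ be positive integers with $m,n\ge 3$, let $G=K_m[P_n]$, and let $\delta$ and $\Delta$ denote the minimum and maximum degree of $G$. Then: (i) $\chi_r(G)=2m$ for $1\le r\le 2m-1$; (ii) $\chi_r(G)= r+2+\left\lfloor \frac{r-2m}{m-1}\right\rfloor$ for $2m\le r\le \delta$; (iii) $\chi_r(G)=mn$ for $r\ge \Delta$.
   Context: All graphs are finite, simple, undirected. An $r$-dynamic $k$-coloring of a graph $G$ is a map $c:V(G)\to\{1,\dots,k\}$ such that $c(u)\neq c(v)$ for every edge $uv$, and for every vertex $v$, $|c(N(v))|\ge \min\{r,d(v)\}$, where $N(v)$ is the set of neighbours of $v$ and $d(v)$ its degree. The $r$-dynamic chromatic number $\chi_r(G)$ is the least $k$ for which an $r$-dynamic $k$-coloring exists. $K_m$ is the complete graph on $m$ vertices and $P_n$ the path on $n$ vertices. The lexicographic product $G_1[G_2]$ has vertex set $V(G_1)\times V(G_2)$, with $(g,h)$ adjacent to $(g',h')$ iff $gg'\in E(G_1)$, or $g=g'$ and $hh'\in E(G_2)$. -}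

module Defs where

open import Data.Nat using (ℕ; zero; suc; _+_; _*_; _∸_; _≤_; _⊓_; _≡ᵇ_)
open import Data.Nat.DivMod using (_/_)
open import Data.Bool using (Bool; true; false; _∧_; _∨_; not; if_then_else_)
open import Data.Fin using (Fin; zero; suc; toℕ; remQuot; _≟_)
open import Data.Product using (Σ; ∃; _×_; _,_)
open import Relation.Nullary using (¬_)
open import Relation.Nullary.Decidable using (⌊_⌋)
open import Relation.Binary.PropositionalEquality using (_≡_; _≢_)

Graph : ℕ → Set
Graph N = Fin N → Fin N → Bool

countF : ∀ {N} → (Fin N → Bool) → ℕ
countF {zero}  f = 0
countF {suc N} f = (if f zero then 1 else 0) + countF (λ i → f (suc i))

anyF : ∀ {N} → (Fin N → Bool) → Bool
anyF {zero}  f = false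
anyF {suc N} f = f zero ∨ anyF (λ i → f (suc i))

complete : (m : ℕ) → Graph m
complete m i j = not ⌊ i ≟ j ⌋

path : (n : ℕ) → Graph n
path n i j = ((suc (toℕ i)) ≡ᵇ toℕ j) ∨ ((suc (toℕ j)) ≡ᵇ toℕ i)

lex : ∀ {m n} → Graph m → Graph n → Graph (m * n)
lex {m} {n} G₁ G₂ x y with remQuot {m} n x | remQuot {m} n y
... | g , h | g′ , h′ = G₁ g g′ ∨ (⌊ g ≟ g′ ⌋ ∧ G₂ h h′)

deg : ∀ {N} → Graph N → Fin N → ℕ
deg G v = countF (G v)

IsMinDegree : ∀ {N} → Graph N → ℕ → Set
IsMinDegree G δ = (∃ λ v → deg G v ≡ δ) × (∀ v → δ ≤ deg G v)

IsMaxDegree : ∀ {N} → Graph N → ℕ → Set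
IsMaxDegree G Δ = (∃ λ v → deg G v ≡ Δ) × (∀ v → deg G v ≤ Δ)

nbrColours : ∀ {N k} → Graph N → (Fin N → Fin k) → Fin N → ℕ
nbrColours {k = k} G c v = countF {k} (λ i → anyF (λ u → G v u ∧ ⌊ c u ≟ i ⌋))

IsDynamicColouring : ∀ {N} → (r k : ℕ) → Graph N → (Fin N → Fin k) → Set
IsDynamicColouring r k G c =
  (∀ u v → G u v ≡ true → c u ≢ c v) ×
  (∀ v → r ⊓ deg G v ≤ nbrColours G c v)

HasDynamicColouring : ∀ {N} → (r k : ℕ) → Graph N → Set
HasDynamicColouring r k G = Σ (_ → Fin k) (IsDynamicColouring r k G)

ChiR≡ : ∀ {N} → (r : ℕ) → Graph N → ℕ → Set
ChiR≡ r G k = HasDynamicColouring r k G × (∀ k′ → HasDynamicColouring r k′ G → k ≤ k′)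

-- Floor division with the convention a div′ 0 = 0 (only used with nonzero divisor).
_div′_ : ℕ → ℕ → ℕ
a div′ zero    = 0
a div′ (suc b) = a / suc b

KmPn : (m n : ℕ) → Graph (m * n)
KmPn m n = lex (complete m) (path n)

-- Write a vertex of K_m[P_n] as (g, h): a block g of K_m and a level h on P_n. Vertices in distinct
-- blocks are adjacent, so every colour class of a proper colouring lies inside one block.
-- (iii) Once r ≥ Δ, each vertex must see its neighbours in distinct colours; two vertices of one block
-- have a common neighbour in another block, so the colouring is injective (and the identity works).
-- (i) Levels 0 and 1 form a clique on 2m vertices, and colouring (g, h) by (h mod 2, g) lets every
-- vertex see all 2m - 1 other colours.
-- (ii) The end vertex (g, 0) sees only colours used outside block g plus the colour of (g, 1), and a
-- colour is used outside at most m - 1 blocks; summing over g gives m r ≤ k (m - 1) + m. Conversely,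
-- colour (g, h) by g + h m while that is below k and by g + (h mod 2) m beyond: a vertex of block g
-- sees every colour outside the class g mod m and the colour of its path neighbour, so with k ≤ T m it
-- misses at most T - 1 colours. Both bounds meet at k = r + 2 + ⌊(r - 2m)/(m - 1)⌋.

module Submission where

open import Defs
open import Data.Nat using (ℕ; zero; suc; _+_; _*_; _∸_; _≤_; _<_; _⊓_; _≡ᵇ_; z≤n; s≤s; NonZero; _<?_; _≤?_)
import Data.Nat as ℕ
open import Data.Nat.Properties hiding (suc-injective; _≟_)
open import Data.Nat.DivMod using (_/_; _%_; m≡m%n+[m/n]*n; m%n<n; [m+kn]%n≡m%n; m<n⇒m%n≡m; m<n*o⇒m/o<n)
open import Data.Nat.Tactic.RingSolver using (solve-∀)
open import Algebra.Properties.CommutativeMonoid.Sum +-0-commutativeMonoid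
  using (sum-syntax; sum-cong-≗; ∑-comm; ∑-distrib-+)
open import Data.Bool using (Bool; true; false; _∧_; _∨_; not; if_then_else_)
open import Data.Bool.Properties using (T-≡; ∨-comm; ∧-conicalˡ; ∧-conicalʳ)
open import Data.Fin using (Fin; zero; suc; toℕ; fromℕ<; _≟_; inject₁; inject≤; remQuot; quotient; remainder; combine)
open import Data.Fin.Properties
  using (suc-injective; injective⇒≤; toℕ<n; toℕ-fromℕ<; toℕ-inject₁; toℕ-inject≤; toℕ-injective;
         remQuot-combine; combine-remQuot; combine-surjective; combine-injectiveˡ; combine-injectiveʳ)
open import Data.Product using (∃; _×_; _,_; proj₁; proj₂; uncurry)
open import Data.Sum using (_⊎_; inj₁; inj₂)
open import Function.Base using (_∘_)
open import Function.Bundles using (Equivalence)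
open import Relation.Nullary using (Dec; yes; no; ¬_; contradiction)
open import Relation.Nullary.Decidable using (⌊_⌋; ⌊⌋-map′)
open import Relation.Binary.PropositionalEquality

-- Counting over finite sets

⌊⌋-true : ∀ {a} {A : Set a} (a? : Dec A) → A → ⌊ a? ⌋ ≡ true
⌊⌋-true (yes _) _ = refl
⌊⌋-true (no ¬a) a = contradiction a ¬a

⌊⌋-false : ∀ {a} {A : Set a} (a? : Dec A) → ¬ A → ⌊ a? ⌋ ≡ false
⌊⌋-false (yes a) ¬a = contradiction a ¬a
⌊⌋-false (no _) _ = refl

⌊⌋-true⁻¹ : ∀ {a} {A : Set a} (a? : Dec A) → ⌊ a? ⌋ ≡ true → A
⌊⌋-true⁻¹ (yes a) _ = a

⌊⌋-false⁻¹ : ∀ {a} {A : Set a} (a? : Dec A) → ⌊ a? ⌋ ≡ false → ¬ A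
⌊⌋-false⁻¹ (no ¬a) _ = ¬a

not-true : ∀ {b} → not b ≡ true → b ≡ false
not-true {false} _ = refl

not-false : ∀ {b} → not b ≡ false → b ≡ true
not-false {true} _ = refl

bit : Bool → ℕ
bit b = if b then 1 else 0

bit≤1 : ∀ b → bit b ≤ 1
bit≤1 true = s≤s z≤n
bit≤1 false = z≤n

∑-mono-≤ : ∀ {N} {f g : Fin N → ℕ} → (∀ i → f i ≤ g i) → ∑[ i < N ] f i ≤ ∑[ i < N ] g i
∑-mono-≤ {zero} _ = z≤n
∑-mono-≤ {suc N} f≤g = +-mono-≤ (f≤g zero) (∑-mono-≤ (λ i → f≤g (suc i)))

∑-mono-< : ∀ {N} {f g : Fin N → ℕ} → (∀ i → f i ≤ g i) → ∀ j → f j < g j →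
           ∑[ i < N ] f i < ∑[ i < N ] g i
∑-mono-< {suc N} f≤g zero fj<gj = +-mono-<-≤ fj<gj (∑-mono-≤ (λ i → f≤g (suc i)))
∑-mono-< {suc N} f≤g (suc j) fj<gj = +-mono-≤-< (f≤g zero) (∑-mono-< (λ i → f≤g (suc i)) j fj<gj)

∑-const : ∀ N c → ∑[ i < N ] c ≡ N * c
∑-const zero c = refl
∑-const (suc N) c = cong (c +_) (∑-const N c)

countF≡∑ : ∀ {N} (f : Fin N → Bool) → countF f ≡ ∑[ i < N ] bit (f i)
countF≡∑ {zero} f = refl
countF≡∑ {suc N} f = cong (bit (f zero) +_) (countF≡∑ (λ i → f (suc i)))

anyF-intro : ∀ {N} (f : Fin N → Bool) i → f i ≡ true → anyF f ≡ true
anyF-intro f zero fi rewrite fi = refl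
anyF-intro f (suc i) fi with f zero
... | true = refl
... | false = anyF-intro (λ j → f (suc j)) i fi

anyF-elim : ∀ {N} (f : Fin N → Bool) → anyF f ≡ true → ∃ λ i → f i ≡ true
anyF-elim {suc N} f any with f zero in f0
... | true = zero , f0
... | false with anyF-elim (λ j → f (suc j)) any
...   | i , fi = suc i , fi

anyF-false : ∀ {N} (f : Fin N → Bool) → anyF f ≡ false → ∀ i → f i ≡ false
anyF-false f none i with f i in fi
... | false = refl
... | true = contradiction (trans (sym (anyF-intro f i fi)) none) λ ()

bit-anyF≤countF : ∀ {N} (f : Fin N → Bool) → bit (anyF f) ≤ countF f
bit-anyF≤countF {zero} f = z≤n
bit-anyF≤countF {suc N} f with f zero
... | true = s≤s z≤n
... | false = bit-anyF≤countF (λ i → f (suc i))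

countF-cong : ∀ {N} {f g : Fin N → Bool} → (∀ i → f i ≡ g i) → countF f ≡ countF g
countF-cong {zero} _ = refl
countF-cong {suc N} f≗g = cong₂ (λ b n → bit b + n) (f≗g zero) (countF-cong (λ i → f≗g (suc i)))

countF-mono : ∀ {N} {f g : Fin N → Bool} → (∀ i → f i ≡ true → g i ≡ true) → countF f ≤ countF g
countF-mono {zero} _ = z≤n
countF-mono {suc N} {f} {g} f⊆g with f zero in f0 | g zero in g0
... | true | true = s≤s (countF-mono (λ i → f⊆g (suc i)))
... | true | false = contradiction (trans (sym (f⊆g zero f0)) g0) λ ()
... | false | true = m≤n⇒m≤1+n (countF-mono (λ i → f⊆g (suc i)))
... | false | false = countF-mono (λ i → f⊆g (suc i))

countF-complement : ∀ {N} (f : Fin N → Bool) → countF f + countF (λ i → not (f i)) ≡ N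
countF-complement {zero} f = refl
countF-complement {suc N} f with f zero
... | true = cong suc (countF-complement (λ i → f (suc i)))
... | false = trans (+-suc _ _) (cong suc (countF-complement (λ i → f (suc i))))

countF-none : ∀ {N} (f : Fin N → Bool) → (∀ i → f i ≡ false) → countF f ≡ 0
countF-none {zero} f _ = refl
countF-none {suc N} f none rewrite none zero = countF-none (λ i → f (suc i)) (λ i → none (suc i))

countF-≤1 : ∀ {N} (f : Fin N → Bool) → (∀ i j → f i ≡ true → f j ≡ true → i ≡ j) → countF f ≤ 1
countF-≤1 {zero} f _ = z≤n
countF-≤1 {suc N} f unique with f zero in f0
... | true = ≤-reflexive (cong suc (countF-none (λ i → f (suc i)) none))
  where
  none : ∀ i → f (suc i) ≡ false
  none i with f (suc i) in fi
  ... | true = contradiction (unique zero (suc i) f0 fi) λ ()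
  ... | false = refl
... | false = countF-≤1 (λ i → f (suc i)) (λ i j fi fj → suc-injective (unique (suc i) (suc j) fi fj))

countF-point : ∀ {N} (x : Fin N) → countF (λ j → ⌊ x ≟ j ⌋) ≡ 1
countF-point {suc N} zero = cong suc (countF-none {N} (λ j → ⌊ zero ≟ suc j ⌋) (λ _ → refl))
countF-point (suc x) = trans (countF-cong (λ j → ⌊⌋-map′ (cong suc) suc-injective (x ≟ j))) (countF-point x)

countF-≢ : ∀ {N} (x : Fin N) → countF (λ j → not ⌊ x ≟ j ⌋) ≡ N ∸ 1
countF-≢ {N} x = begin
  others                          ≡⟨ sym (m+n∸m≡n 1 others) ⟩
  1 + others ∸ 1                  ≡⟨ cong (λ n → n + others ∸ 1) (sym (countF-point x)) ⟩
  countF (λ j → ⌊ x ≟ j ⌋) + others ∸ 1 ≡⟨ cong (_∸ 1) (countF-complement (λ j → ⌊ x ≟ j ⌋)) ⟩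
  N ∸ 1                           ∎
  where
  open ≡-Reasoning
  others = countF (λ j → not ⌊ x ≟ j ⌋)

countF-≥-∸ : ∀ {N} {f g : Fin N → Bool} → (∀ i → g i ≡ false → f i ≡ true) → N ∸ countF g ≤ countF f
countF-≥-∸ {N} {f} {g} f-outside-g = begin
  N ∸ countF g              ≤⟨ ∸-monoʳ-≤ N (countF-mono ¬f⊆g) ⟩
  N ∸ c̄                     ≡⟨ cong (_∸ c̄) (sym (countF-complement f)) ⟩
  countF f + c̄ ∸ c̄          ≡⟨ m+n∸n≡m (countF f) c̄ ⟩
  countF f                  ∎
  where
  open ≤-Reasoning
  c̄ = countF (λ i → not (f i))
  ¬f⊆g : ∀ i → not (f i) ≡ true → g i ≡ true
  ¬f⊆g i ¬fi with g i in gi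
  ... | true = refl
  ... | false with f i | f-outside-g i gi
  ¬f⊆g i () | false | true | refl

countF-∪ : ∀ {N} {f g h : Fin N → Bool} → (∀ i → f i ≡ true → g i ≡ true ⊎ h i ≡ true) →
           countF f ≤ countF g + countF h
countF-∪ {N} {f} {g} {h} f⊆g∪h = begin
  countF f                                   ≡⟨ countF≡∑ f ⟩
  ∑[ i < N ] bit (f i)                       ≤⟨ ∑-mono-≤ bit-∪ ⟩
  ∑[ i < N ] (bit (g i) + bit (h i))         ≡⟨ ∑-distrib-+ (λ i → bit (g i)) (λ i → bit (h i)) ⟩
  ∑[ i < N ] bit (g i) + ∑[ i < N ] bit (h i) ≡⟨ sym (cong₂ _+_ (countF≡∑ g) (countF≡∑ h)) ⟩
  countF g + countF h                        ∎
  where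
  open ≤-Reasoning
  bit-∪ : ∀ i → bit (f i) ≤ bit (g i) + bit (h i)
  bit-∪ i with f i in fi
  ... | false = z≤n
  ... | true with f⊆g∪h i fi
  ...   | inj₁ gi rewrite gi = s≤s z≤n
  ...   | inj₂ hi rewrite hi = m≤n+m 1 (bit (g i))

∑-countF-comm : ∀ {M K} (f : Fin M → Fin K → Bool) →
                ∑[ g < M ] countF (f g) ≡ ∑[ i < K ] countF (λ g → f g i)
∑-countF-comm {M} {K} f = begin
  ∑[ g < M ] countF (f g)                   ≡⟨ sum-cong-≗ (λ g → countF≡∑ (f g)) ⟩
  ∑[ g < M ] ∑[ i < K ] bit (f g i)         ≡⟨ ∑-comm (λ g i → bit (f g i)) ⟩
  ∑[ i < K ] ∑[ g < M ] bit (f g i)         ≡⟨ sum-cong-≗ (λ i → sym (countF≡∑ (λ g → f g i))) ⟩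
  ∑[ i < K ] countF (λ g → f g i)           ∎
  where open ≡-Reasoning

∑-bit-fibre : ∀ {M} b (x : Fin M) → ∑[ j < M ] bit (b ∧ ⌊ x ≟ j ⌋) ≡ bit b
∑-bit-fibre {M} false x = trans (∑-const M 0) (*-zeroʳ M)
∑-bit-fibre true x = trans (sym (countF≡∑ (λ j → ⌊ x ≟ j ⌋))) (countF-point x)

countF-fibres : ∀ {N M} (f : Fin N → Bool) (φ : Fin N → Fin M) →
                countF f ≡ ∑[ j < M ] countF (λ i → f i ∧ ⌊ φ i ≟ j ⌋)
countF-fibres {N} {M} f φ = begin
  countF f                                          ≡⟨ countF≡∑ f ⟩
  ∑[ i < N ] bit (f i)                              ≡⟨ sum-cong-≗ (λ i → sym (∑-bit-fibre (f i) (φ i))) ⟩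
  ∑[ i < N ] ∑[ j < M ] bit (f i ∧ ⌊ φ i ≟ j ⌋)     ≡⟨ ∑-comm (λ i j → bit (f i ∧ ⌊ φ i ≟ j ⌋)) ⟩
  ∑[ j < M ] ∑[ i < N ] bit (f i ∧ ⌊ φ i ≟ j ⌋)     ≡⟨ sum-cong-≗ (λ j → sym (countF≡∑ (λ i → f i ∧ ⌊ φ i ≟ j ⌋))) ⟩
  ∑[ j < M ] countF (λ i → f i ∧ ⌊ φ i ≟ j ⌋)       ∎
  where open ≡-Reasoning

countF-injection : ∀ {N M} {f : Fin N → Bool} {g : Fin M → Bool} (φ : Fin N → Fin M) →
                   (∀ i → f i ≡ true → g (φ i) ≡ true) →
                   (∀ i j → f i ≡ true → f j ≡ true → φ i ≡ φ j → i ≡ j) →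
                   countF f ≤ countF g
countF-injection {N} {M} {f} {g} φ φ-maps φ-injective = begin
  countF f                        ≡⟨ countF-fibres f φ ⟩
  ∑[ j < M ] countF (fibre j)     ≤⟨ ∑-mono-≤ fibre≤ ⟩
  ∑[ j < M ] bit (g j)            ≡⟨ sym (countF≡∑ g) ⟩
  countF g                        ∎
  where
  open ≤-Reasoning
  fibre : Fin M → Fin N → Bool
  fibre j i = f i ∧ ⌊ φ i ≟ j ⌋
  fibre⇒f : ∀ {j i} → fibre j i ≡ true → f i ≡ true
  fibre⇒f {j} {i} p = ∧-conicalˡ (f i) _ p
  fibre⇒φ : ∀ {j i} → fibre j i ≡ true → φ i ≡ j
  fibre⇒φ {j} {i} p = ⌊⌋-true⁻¹ (φ i ≟ j) (∧-conicalʳ (f i) _ p)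
  fibre≤ : ∀ j → countF (fibre j) ≤ bit (g j)
  fibre≤ j with g j in gj
  ... | true = countF-≤1 (fibre j) λ i i′ p p′ →
                 φ-injective i i′ (fibre⇒f p) (fibre⇒f p′) (trans (fibre⇒φ p) (sym (fibre⇒φ p′)))
  ... | false = ≤-reflexive (countF-none (fibre j) empty)
    where
    empty : ∀ i → fibre j i ≡ false
    empty i with fibre j i in p
    ... | false = refl
    ... | true = contradiction (trans (sym (subst (λ x → g x ≡ true) (fibre⇒φ p) (φ-maps i (fibre⇒f p)))) gj) λ ()

countF-image< : ∀ {N K} (f : Fin N → Bool) (c : Fin N → Fin K) {u w : Fin N} → u ≢ w →
                f u ≡ true → f w ≡ true → c u ≡ c w →
                countF (λ j → anyF (λ x → f x ∧ ⌊ c x ≟ j ⌋)) < countF f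
countF-image< {N} {K} f c {u} {w} u≢w fu fw cu≡cw = begin-strict
  countF (λ j → anyF (fibre j))        ≡⟨ countF≡∑ (λ j → anyF (fibre j)) ⟩
  ∑[ j < K ] bit (anyF (fibre j))      <⟨ ∑-mono-< (λ j → bit-anyF≤countF (fibre j)) (c u) collision ⟩
  ∑[ j < K ] countF (fibre j)          ≡⟨ sym (countF-fibres f c) ⟩
  countF f                             ∎
  where
  open ≤-Reasoning
  fibre : Fin K → Fin N → Bool
  fibre j x = f x ∧ ⌊ c x ≟ j ⌋
  pair : Fin 2 → Fin N
  pair zero = u
  pair (suc _) = w
  in-fibre : ∀ b → fibre (c u) (pair b) ≡ true
  in-fibre zero rewrite fu = ⌊⌋-true (c u ≟ c u) refl
  in-fibre (suc _) rewrite fw = ⌊⌋-true (c w ≟ c u) (sym cu≡cw)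
  pair-injective : ∀ a b → pair a ≡ pair b → a ≡ b
  pair-injective zero zero _ = refl
  pair-injective zero (suc zero) u≡w = contradiction u≡w u≢w
  pair-injective (suc zero) zero w≡u = contradiction (sym w≡u) u≢w
  pair-injective (suc zero) (suc zero) _ = refl
  collision : bit (anyF (fibre (c u))) < countF (fibre (c u))
  collision = ≤-<-trans (bit≤1 (anyF (fibre (c u))))
    (countF-injection {f = λ _ → true} pair (λ b _ → in-fibre b) (λ a b _ _ → pair-injective a b))

-- Dynamic colourings of arbitrary graphs

colourSeen : ∀ {N k} → Graph N → (Fin N → Fin k) → Fin N → Fin k → Bool
colourSeen G c v i = anyF (λ u → G v u ∧ ⌊ c u ≟ i ⌋)

colourSeen-intro : ∀ {N k} (G : Graph N) (c : Fin N → Fin k) {v u i} →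
                   G v u ≡ true → c u ≡ i → colourSeen G c v i ≡ true
colourSeen-intro G c {v} {u} {i} vu cu≡i =
  anyF-intro (λ x → G v x ∧ ⌊ c x ≟ i ⌋) u (cong₂ _∧_ vu (⌊⌋-true (c u ≟ i) cu≡i))

module _ {N} {G : Graph N} where

  dynamic-mono : ∀ {r r′ k} → r ≤ r′ → HasDynamicColouring r′ k G → HasDynamicColouring r k G
  dynamic-mono {r} r≤r′ (c , proper , dynamic) =
    c , proper , λ v → ≤-trans (⊓-monoˡ-≤ (deg G v) r≤r′) (dynamic v)

  identity-colouring : (∀ v → G v v ≡ false) → ∀ r → HasDynamicColouring r N G
  identity-colouring loopless r = (λ v → v) , proper , dynamic
    where
    proper : ∀ u v → G u v ≡ true → u ≢ v
    proper u v uv refl = contradiction (trans (sym uv) (loopless u)) λ ()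
    dynamic : ∀ v → r ⊓ deg G v ≤ nbrColours G (λ u → u) v
    dynamic v = ≤-trans (m⊓n≤n r (deg G v))
      (countF-injection {f = G v} {g = colourSeen G (λ u → u) v} (λ u → u)
        (λ u vu → colourSeen-intro G (λ x → x) vu refl) (λ _ _ _ _ eq → eq))

  clique-size≤colours : ∀ {s r k} (φ : Fin s → Fin N) → (∀ x y → x ≢ y → G (φ x) (φ y) ≡ true) →
                        HasDynamicColouring r k G → s ≤ k
  clique-size≤colours φ clique (c , proper , _) = injective⇒≤ injective
    where
    injective : ∀ {x y} → c (φ x) ≡ c (φ y) → x ≡ y
    injective {x} {y} cx≡cy with x ≟ y
    ... | yes x≡y = x≡y
    ... | no x≢y = contradiction cx≡cy (proper (φ x) (φ y) (clique x y x≢y))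

  rainbow-neighbourhood : ∀ {r k c} → IsDynamicColouring r k G c → ∀ {v u w} → deg G v ≤ r →
                          G v u ≡ true → G v w ≡ true → c u ≡ c w → u ≡ w
  rainbow-neighbourhood {r} {c = c} (_ , dynamic) {v} {u} {w} deg≤r vu vw cu≡cw with u ≟ w
  ... | yes u≡w = u≡w
  ... | no u≢w = contradiction (countF-image< (G v) c u≢w vu vw cu≡cw) (≤⇒≯ deg≤nbr)
    where
    deg≤nbr : deg G v ≤ nbrColours G c v
    deg≤nbr = subst (_≤ nbrColours G c v) (m≥n⇒m⊓n≡n deg≤r) (dynamic v)

  order≤colours : ∀ {r k} → (∀ v → deg G v ≤ r) →
                  (∀ u w → u ≢ w → G u w ≡ true ⊎ ∃ λ v → G v u ≡ true × G v w ≡ true) →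
                  HasDynamicColouring r k G → N ≤ k
  order≤colours deg≤r close (c , colouring) = injective⇒≤ injective
    where
    injective : ∀ {u w} → c u ≡ c w → u ≡ w
    injective {u} {w} cu≡cw with u ≟ w
    ... | yes u≡w = u≡w
    ... | no u≢w with close u w u≢w
    ...   | inj₁ uw = contradiction cu≡cw (proj₁ colouring u w uw)
    ...   | inj₂ (v , vu , vw) = rainbow-neighbourhood colouring (deg≤r v) vu vw cu≡cw

-- Paths, parity and division

path-sym : ∀ {n} (h h′ : Fin n) → path n h h′ ≡ path n h′ h
path-sym h h′ = ∨-comm (suc (toℕ h) ≡ᵇ toℕ h′) _

path⇒consecutive : ∀ {n} (h h′ : Fin n) → path n h h′ ≡ true →
                   toℕ h′ ≡ suc (toℕ h) ⊎ toℕ h ≡ suc (toℕ h′)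
path⇒consecutive h h′ hh′ with suc (toℕ h) ≡ᵇ toℕ h′ in up
... | true = inj₁ (sym (≡ᵇ⇒≡ _ _ (Equivalence.from T-≡ up)))
... | false = inj₂ (sym (≡ᵇ⇒≡ _ _ (Equivalence.from T-≡ hh′)))

consecutive⇒path : ∀ {n} {h h′ : Fin n} → toℕ h′ ≡ suc (toℕ h) → path n h h′ ≡ true
consecutive⇒path {h = h} {h′} h′≡1+h =
  cong (_∨ (suc (toℕ h′) ≡ᵇ toℕ h)) (Equivalence.to T-≡ (≡⇒≡ᵇ _ _ (sym h′≡1+h)))

path-irreflexive : ∀ {n} (h : Fin n) → path n h h ≡ false
path-irreflexive {n} h with path n h h in hh
... | false = refl
... | true with path⇒consecutive h h hh
...   | inj₁ h≡1+h = contradiction (sym h≡1+h) 1+n≢n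
...   | inj₂ h≡1+h = contradiction (sym h≡1+h) 1+n≢n

path-neighbour : ∀ {n} → 1 < n → (h : Fin n) → ∃ λ h′ → path n h h′ ≡ true
path-neighbour (s≤s (s≤s z≤n)) zero = suc zero , refl
path-neighbour (s≤s (s≤s z≤n)) (suc h) =
  inject₁ h , trans (path-sym (suc h) (inject₁ h)) (consecutive⇒path (cong suc (sym (toℕ-inject₁ h))))

parity : ℕ → Fin 2
parity zero = zero
parity (suc zero) = suc zero
parity (suc (suc h)) = parity h

parity-suc : ∀ h → parity (suc h) ≢ parity h
parity-suc zero = λ ()
parity-suc (suc zero) = λ ()
parity-suc (suc (suc h)) = parity-suc h

parity-toℕ : (b : Fin 2) → parity (toℕ b) ≡ b
parity-toℕ zero = refl
parity-toℕ (suc zero) = refl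

Fin2-≢-unique : ∀ {x y z : Fin 2} → x ≢ z → y ≢ z → x ≡ y
Fin2-≢-unique {zero} {zero} _ _ = refl
Fin2-≢-unique {suc zero} {suc zero} _ _ = refl
Fin2-≢-unique {zero} {suc zero} {zero} x≢z _ = contradiction refl x≢z
Fin2-≢-unique {zero} {suc zero} {suc zero} _ y≢z = contradiction refl y≢z
Fin2-≢-unique {suc zero} {zero} {zero} _ y≢z = contradiction refl y≢z
Fin2-≢-unique {suc zero} {zero} {suc zero} x≢z _ = contradiction refl x≢z

path⇒parity≢ : ∀ {n} (h h′ : Fin n) → path n h h′ ≡ true → parity (toℕ h) ≢ parity (toℕ h′)
path⇒parity≢ h h′ hh′ with path⇒consecutive h h′ hh′
... | inj₁ h′≡1+h rewrite h′≡1+h = λ eq → parity-suc (toℕ h) (sym eq)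
... | inj₂ h≡1+h′ rewrite h≡1+h′ = parity-suc (toℕ h′)

h≢parity-suc : ∀ h → h ≢ toℕ (parity (suc h))
h≢parity-suc zero = λ ()
h≢parity-suc (suc zero) = λ ()
h≢parity-suc (suc (suc h)) eq = contradiction (subst (_< 2) (sym eq) (toℕ<n (parity (suc (suc (suc h))))))
                                              (≤⇒≯ (s≤s (s≤s z≤n)))

%-/-injective : ∀ {x y} m .{{_ : NonZero m}} → x % m ≡ y % m → x / m ≡ y / m → x ≡ y
%-/-injective {x} {y} m x%m≡y%m x/m≡y/m = begin
  x                   ≡⟨ m≡m%n+[m/n]*n x m ⟩
  x % m + x / m * m   ≡⟨ cong₂ (λ a b → a + b * m) x%m≡y%m x/m≡y/m ⟩
  y % m + y / m * m   ≡⟨ sym (m≡m%n+[m/n]*n y m) ⟩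
  y                   ∎
  where open ≡-Reasoning

∃≢ : ∀ {m} → 1 < m → (g : Fin m) → ∃ λ g′ → g′ ≢ g
∃≢ (s≤s (s≤s z≤n)) zero = suc zero , λ ()
∃≢ (s≤s (s≤s z≤n)) (suc g) = zero , λ ()

-- Writing r = s + (2 + q) D with 2 ≤ s ≤ D + 1 (from dividing r - 2(D + 1) by D) turns every
-- inequality of the middle range into a comparison of coefficients of D.
module Excess (D r : ℕ) .{{_ : NonZero D}} (2[1+D]≤r : 2 * suc D ≤ r) where

  q s : ℕ
  q = (r ∸ 2 * suc D) / D
  s = 2 + (r ∸ 2 * suc D) % D

  s≤1+D : s ≤ suc D
  s≤1+D = s≤s (m%n<n (r ∸ 2 * suc D) D)

  r≡s+[2+q]D : r ≡ s + (2 + q) * D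
  r≡s+[2+q]D = begin
    r                                     ≡⟨ sym (m+[n∸m]≡n 2[1+D]≤r) ⟩
    2 * suc D + (r ∸ 2 * suc D)           ≡⟨ cong (2 * suc D +_) (m≡m%n+[m/n]*n (r ∸ 2 * suc D) D) ⟩
    2 * suc D + ((r ∸ 2 * suc D) % D + q * D) ≡⟨ regroup D ((r ∸ 2 * suc D) % D) q ⟩
    s + (2 + q) * D                       ∎
    where
    open ≡-Reasoning
    regroup : ∀ D ρ q → 2 * suc D + (ρ + q * D) ≡ 2 + ρ + (2 + q) * D
    regroup = solve-∀

  colours-needed : ∀ k′ → suc D * r ≤ k′ * D + suc D → r + 2 + q ≤ k′
  colours-needed k′ bound = ≤-pred (*-cancelʳ-< D (r + 2 + q) (suc k′) (≤-pred (begin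
    suc (suc ((r + 2 + q) * D))     ≡⟨ +-comm 2 _ ⟩
    (r + 2 + q) * D + 2             ≤⟨ +-monoʳ-≤ _ (m≤m+n 2 _) ⟩
    (r + 2 + q) * D + s             ≡⟨ sym multiple ⟩
    suc D * r                       ≤⟨ bound ⟩
    k′ * D + suc D                  ≡⟨ +-suc (k′ * D) D ⟩
    suc (k′ * D + D)                ≡⟨ cong suc (+-comm (k′ * D) D) ⟩
    suc (suc k′ * D)                ∎)))
    where
    open ≤-Reasoning
    regroup : ∀ r s q D → s + (2 + q) * D + D * r ≡ (r + 2 + q) * D + s
    regroup = solve-∀
    multiple : suc D * r ≡ (r + 2 + q) * D + s
    multiple = trans (cong (_+ D * r) r≡s+[2+q]D) (regroup r s q D)

  colours-fit : r + 2 + q ≤ (3 + q) * suc D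
  colours-fit = begin
    r + 2 + q                        ≡⟨ cong (λ x → x + 2 + q) r≡s+[2+q]D ⟩
    s + (2 + q) * D + 2 + q          ≡⟨ regroup s q D ⟩
    s + (2 + q) + (2 + q) * D        ≤⟨ +-monoˡ-≤ _ (+-monoˡ-≤ (2 + q) s≤1+D) ⟩
    suc D + (2 + q) + (2 + q) * D    ≡⟨ expand q D ⟩
    (3 + q) * suc D                  ∎
    where
    open ≤-Reasoning
    regroup : ∀ x q D → x + (2 + q) * D + 2 + q ≡ x + (2 + q) + (2 + q) * D
    regroup = solve-∀
    expand : ∀ q D → suc D + (2 + q) + (2 + q) * D ≡ (3 + q) * suc D
    expand = solve-∀

  rows-fit : ∀ n → r + (n ∸ 1) ≤ suc D * n → 3 + q ≤ n
  rows-fit n bound with 3 + q ≤? n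
  ... | yes fits = fits
  ... | no ¬fits = contradiction bound (<⇒≱ (begin-strict
    suc D * n                           ≤⟨ +-mono-≤ (m≤n+m∸n n 1) (*-monoʳ-≤ D (≤-pred (≰⇒> ¬fits))) ⟩
    1 + (n ∸ 1) + D * (2 + q)           ≡⟨ sym (+-suc (n ∸ 1) (D * (2 + q))) ⟩
    n ∸ 1 + (1 + D * (2 + q))           <⟨ +-monoʳ-< (n ∸ 1) (n<1+n _) ⟩
    n ∸ 1 + (2 + D * (2 + q))           ≤⟨ +-monoʳ-≤ (n ∸ 1) (subst (λ x → 2 + x ≤ s + (2 + q) * D) (*-comm (2 + q) D)
                                             (+-monoˡ-≤ ((2 + q) * D) (m≤m+n 2 ((r ∸ 2 * suc D) % D)))) ⟩
    n ∸ 1 + (s + (2 + q) * D)           ≡⟨ cong (n ∸ 1 +_) (sym r≡s+[2+q]D) ⟩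
    n ∸ 1 + r                           ≡⟨ +-comm (n ∸ 1) r ⟩
    r + (n ∸ 1)                         ∎))
    where open ≤-Reasoning

  excess-cancel : r + 2 + q ∸ (3 + q ∸ 1) ≡ r
  excess-cancel = trans (cong (_∸ (2 + q)) (+-assoc r 2 q)) (m+n∸n≡m r (2 + q))

-- The graph K_m[P_n]

module KmPnProperties (m n : ℕ) where

  V : Set
  V = Fin (m * n)

  block : V → Fin m
  block = quotient n

  level : V → Fin n
  level = remainder {m} n

  vertex : Fin m → Fin n → V
  vertex = combine

  block-vertex : ∀ g h → block (vertex g h) ≡ g
  block-vertex g h = cong proj₁ (remQuot-combine g h)

  level-vertex : ∀ g h → level (vertex g h) ≡ h
  level-vertex g h = cong proj₂ (remQuot-combine g h)

  vertex-block-level : ∀ u → vertex (block u) (level u) ≡ u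
  vertex-block-level = combine-remQuot {m} n

  adjacency : ∀ u v → KmPn m n u v ≡
              not ⌊ block u ≟ block v ⌋ ∨ (⌊ block u ≟ block v ⌋ ∧ path n (level u) (level v))
  adjacency u v with remQuot {m} n u | remQuot {m} n v
  ... | g , h | g′ , h′ = refl

  adjacent-across : ∀ {u v} → block u ≢ block v → KmPn m n u v ≡ true
  adjacent-across {u} {v} u≁v rewrite adjacency u v | ⌊⌋-false (block u ≟ block v) u≁v = refl

  adjacent-within⁻¹ : ∀ {u v} → KmPn m n u v ≡ true → block u ≡ block v → path n (level u) (level v) ≡ true
  adjacent-within⁻¹ {u} {v} uv same rewrite adjacency u v | ⌊⌋-true (block u ≟ block v) same = uv

  loopless : ∀ u → KmPn m n u u ≡ false
  loopless u rewrite adjacency u u | ⌊⌋-true (block u ≟ block u) refl = path-irreflexive (level u)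

  vertex-adjacent-across : ∀ {g g′} h h′ → g ≢ g′ → KmPn m n (vertex g h) (vertex g′ h′) ≡ true
  vertex-adjacent-across {g} {g′} h h′ g≢g′ =
    adjacent-across (λ eq → g≢g′ (trans (sym (block-vertex g h)) (trans eq (block-vertex g′ h′))))

  vertex-adjacent-within : ∀ g {h h′} → path n h h′ ≡ true → KmPn m n (vertex g h) (vertex g h′) ≡ true
  vertex-adjacent-within g {h} {h′} hh′
    rewrite adjacency (vertex g h) (vertex g h′) | block-vertex g h | block-vertex g h′
          | level-vertex g h | level-vertex g h′ | ⌊⌋-true (g ≟ g) refl = hh′

  adjacent-to-vertex-across : ∀ {v g} h → block v ≢ g → KmPn m n v (vertex g h) ≡ true
  adjacent-to-vertex-across {v} {g} h v≁g =
    subst (λ x → KmPn m n x (vertex g h) ≡ true) (vertex-block-level v) (vertex-adjacent-across (level v) h v≁g)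

  adjacent-to-vertex-within : ∀ {v h} → path n (level v) h ≡ true → KmPn m n v (vertex (block v) h) ≡ true
  adjacent-to-vertex-within {v} {h} vh =
    subst (λ x → KmPn m n x (vertex (block v) h) ≡ true) (vertex-block-level v) (vertex-adjacent-within (block v) vh)

  adjacent-or-common-neighbour : 1 < m → ∀ u w →
                                 KmPn m n u w ≡ true ⊎ ∃ λ v → KmPn m n v u ≡ true × KmPn m n v w ≡ true
  adjacent-or-common-neighbour 1<m u w = by-blocks (block u ≟ block w)
    where
    g′ = proj₁ (∃≢ 1<m (block u))
    g′≢g = proj₂ (∃≢ 1<m (block u))
    across : ∀ x → block u ≡ block x → KmPn m n (vertex g′ (level u)) x ≡ true
    across x u∼x = adjacent-across (λ eq → g′≢g (trans (sym (block-vertex g′ (level u))) (trans eq (sym u∼x))))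
    by-blocks : Dec (block u ≡ block w) →
                KmPn m n u w ≡ true ⊎ ∃ λ v → KmPn m n v u ≡ true × KmPn m n v w ≡ true
    by-blocks (no u≁w) = inj₁ (adjacent-across u≁w)
    by-blocks (yes same) = inj₂ (vertex g′ (level u) , across u refl , across w same)

  chi-large : 1 < m → ∀ {r} → (∀ v → deg (KmPn m n) v ≤ r) → ChiR≡ r (KmPn m n) (m * n)
  chi-large 1<m {r} deg≤r = identity-colouring loopless r
                          , λ _ → order≤colours deg≤r (λ u w _ → adjacent-or-common-neighbour 1<m u w)

  module _ (1<n : 1 < n) where

    low : Fin 2 → Fin n
    low b = inject≤ b 1<n

    toℕ-low : ∀ b → toℕ (low b) ≡ toℕ b
    toℕ-low b = toℕ-inject≤ b 1<n

    low-0-1 : toℕ (low (suc zero)) ≡ suc (toℕ (low zero))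
    low-0-1 = trans (toℕ-low (suc zero)) (cong suc (sym (toℕ-low zero)))

    path-low : ∀ {b b′} → b ≢ b′ → path n (low b) (low b′) ≡ true
    path-low {zero} {zero} b≢b′ = contradiction refl b≢b′
    path-low {zero} {suc zero} _ = consecutive⇒path low-0-1
    path-low {suc zero} {zero} _ = trans (path-sym (low (suc zero)) (low zero)) (consecutive⇒path low-0-1)
    path-low {suc zero} {suc zero} b≢b′ = contradiction refl b≢b′

    parity-colour : V → Fin (2 * m)
    parity-colour u = combine (parity (toℕ (level u))) (block u)

    parity-colour-vertex : ∀ g h → parity-colour (vertex g h) ≡ combine (parity (toℕ h)) g
    parity-colour-vertex g h rewrite level-vertex g h | block-vertex g h = refl

    parity-colour-seen : ∀ v b g → combine b g ≢ parity-colour v →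
                         colourSeen (KmPn m n) parity-colour v (combine b g) ≡ true
    parity-colour-seen v b g b,g≢ with block v ≟ g
    ... | no v≁g = colourSeen-intro (KmPn m n) parity-colour (adjacent-to-vertex-across (low b) v≁g)
        (trans (parity-colour-vertex g (low b)) (cong (λ p → combine p g) parity-low))
      where
      parity-low : parity (toℕ (low b)) ≡ b
      parity-low = trans (cong parity (toℕ-low b)) (parity-toℕ b)
    ... | yes refl with path-neighbour 1<n (level v)
    ...   | h′ , vh′ = colourSeen-intro (KmPn m n) parity-colour (adjacent-to-vertex-within vh′)
        (trans (parity-colour-vertex (block v) h′) (cong (λ p → combine p (block v)) parity-h′))
      where
      parity-h′ : parity (toℕ h′) ≡ b
      parity-h′ = Fin2-≢-unique (λ eq → path⇒parity≢ (level v) h′ vh′ (sym eq))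
                                (λ eq → b,g≢ (cong (λ p → combine p (block v)) eq))

    parity-colouring : HasDynamicColouring (2 * m ∸ 1) (2 * m) (KmPn m n)
    parity-colouring = parity-colour , proper , dynamic
      where
      proper : ∀ u v → KmPn m n u v ≡ true → parity-colour u ≢ parity-colour v
      proper u v uv cu≡cv = path⇒parity≢ (level u) (level v)
        (adjacent-within⁻¹ uv (combine-injectiveʳ pu (block u) pv (block v) cu≡cv))
        (combine-injectiveˡ pu (block u) pv (block v) cu≡cv)
        where
        pu = parity (toℕ (level u))
        pv = parity (toℕ (level v))
      seen : ∀ v i → ⌊ parity-colour v ≟ i ⌋ ≡ false → colourSeen (KmPn m n) parity-colour v i ≡ true
      seen v i i≢cv with combine-surjective {2} {m} i
      ... | b , g , refl = parity-colour-seen v b g (⌊⌋-false⁻¹ (parity-colour v ≟ combine b g) i≢cv ∘ sym)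
      dynamic : ∀ v → (2 * m ∸ 1) ⊓ deg (KmPn m n) v ≤ nbrColours (KmPn m n) parity-colour v
      dynamic v = ≤-trans (m⊓n≤m _ _)
        (subst (λ x → 2 * m ∸ x ≤ nbrColours (KmPn m n) parity-colour v) (countF-point (parity-colour v))
               (countF-≥-∸ (seen v)))

    two-level-adjacent : ∀ {b g b′ g′} → (b , g) ≢ (b′ , g′) →
                         KmPn m n (vertex g (low b)) (vertex g′ (low b′)) ≡ true
    two-level-adjacent {b} {g} {b′} {g′} distinct with g ≟ g′
    ... | no g≢g′ = vertex-adjacent-across (low b) (low b′) g≢g′
    ... | yes refl = vertex-adjacent-within g (path-low (λ b≡b′ → distinct (cong (_, g) b≡b′)))

    two-level-clique : Fin (2 * m) → V
    two-level-clique x = vertex (proj₂ (remQuot {2} m x)) (low (proj₁ (remQuot {2} m x)))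

    two-level-clique-adjacent : ∀ x y → x ≢ y → KmPn m n (two-level-clique x) (two-level-clique y) ≡ true
    two-level-clique-adjacent x y x≢y = two-level-adjacent λ eq →
      x≢y (trans (sym (combine-remQuot {2} m x)) (trans (cong (uncurry combine) eq) (combine-remQuot {2} m y)))

    chi-small : ∀ {r} → r ≤ 2 * m ∸ 1 → ChiR≡ r (KmPn m n) (2 * m)
    chi-small r≤ = dynamic-mono r≤ parity-colouring
                 , λ _ → clique-size≤colours two-level-clique two-level-clique-adjacent

    end next : Fin m → V
    end g = vertex g (low zero)
    next g = vertex g (low (suc zero))

    end-neighbour : ∀ {g u} → KmPn m n (end g) u ≡ true → block u ≡ g → u ≡ next g
    end-neighbour {g} {u} adj u∈g = begin
      u                          ≡⟨ sym (vertex-block-level u) ⟩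
      vertex (block u) (level u) ≡⟨ cong₂ vertex u∈g (toℕ-injective level-u) ⟩
      next g                     ∎
      where
      open ≡-Reasoning
      path-end : path n (low zero) (level u) ≡ true
      path-end = subst (λ h → path n h (level u) ≡ true) (level-vertex g (low zero))
                   (adjacent-within⁻¹ adj (trans (block-vertex g (low zero)) (sym u∈g)))
      level-u : toℕ (level u) ≡ toℕ (low (suc zero))
      level-u with path⇒consecutive (low zero) (level u) path-end
      ... | inj₁ u≡1+0 = trans u≡1+0 (trans (cong suc (toℕ-low zero)) (sym (toℕ-low (suc zero))))
      ... | inj₂ 0≡1+u = contradiction (trans (sym (toℕ-low zero)) 0≡1+u) 0≢1+n

    end-degree : ∀ g → deg (KmPn m n) (end g) + (n ∸ 1) ≤ m * n
    end-degree g = begin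
      d + (n ∸ 1)                                       ≡⟨ cong (d +_) (sym (countF-≢ (low (suc zero)))) ⟩
      d + countF (λ h → not ⌊ low (suc zero) ≟ h ⌋)     ≤⟨ +-monoʳ-≤ d (countF-injection (vertex g) non-adjacent injective) ⟩
      d + countF (λ u → not (KmPn m n (end g) u))       ≡⟨ countF-complement (KmPn m n (end g)) ⟩
      m * n                                             ∎
      where
      open ≤-Reasoning
      d = deg (KmPn m n) (end g)
      non-adjacent : ∀ h → not ⌊ low (suc zero) ≟ h ⌋ ≡ true → not (KmPn m n (end g) (vertex g h)) ≡ true
      non-adjacent h h≢ with KmPn m n (end g) (vertex g h) in adj
      ... | false = refl
      ... | true = contradiction (combine-injectiveʳ g h g _ (end-neighbour adj (block-vertex g h)))
                                 (⌊⌋-false⁻¹ (low (suc zero) ≟ h) (not-true h≢) ∘ sym)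
      injective : ∀ h h′ → not ⌊ low (suc zero) ≟ h ⌋ ≡ true → not ⌊ low (suc zero) ≟ h′ ⌋ ≡ true →
                  vertex g h ≡ vertex g h′ → h ≡ h′
      injective h h′ _ _ = combine-injectiveʳ g h g h′

    module _ {r k} (r≤deg : ∀ v → r ≤ deg (KmPn m n) v) (col : HasDynamicColouring r k (KmPn m n)) where

      private
        c = proj₁ col

      usedOutside : Fin m → Fin k → Bool
      usedOutside g i = anyF (λ u → not ⌊ block u ≟ g ⌋ ∧ ⌊ c u ≟ i ⌋)

      colour-class-in-one-block : ∀ {u u′} → c u ≡ c u′ → block u ≡ block u′
      colour-class-in-one-block {u} {u′} cu≡cu′ with block u ≟ block u′
      ... | yes same = same
      ... | no different = contradiction cu≡cu′ (proj₁ (proj₂ col) u u′ (adjacent-across different))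

      usedOutside-witness : ∀ {g i} → usedOutside g i ≡ true → ∃ λ u → block u ≢ g × c u ≡ i
      usedOutside-witness {g} {i} used with anyF-elim _ used
      ... | u , p = u , ⌊⌋-false⁻¹ (block u ≟ g) (not-true (∧-conicalˡ _ _ p)) , ⌊⌋-true⁻¹ (c u ≟ i) (∧-conicalʳ _ _ p)

      -- A colour class lies inside one block, so a used colour is used outside every block but that one.
      usedOutside-count : ∀ i → countF (λ g → usedOutside g i) ≤ m ∸ 1
      usedOutside-count i with anyF (λ g → usedOutside g i) in some
      ... | false = ≤-trans (≤-reflexive (countF-none _ (anyF-false (λ g → usedOutside g i) some))) z≤n
      ... | true with usedOutside-witness (proj₂ (anyF-elim (λ g → usedOutside g i) some))
      ...   | u , _ , cu≡i = begin
        countF (λ g → usedOutside g i)       ≤⟨ countF-mono avoids-block-u ⟩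
        countF (λ g → not ⌊ block u ≟ g ⌋)   ≡⟨ countF-≢ (block u) ⟩
        m ∸ 1                                ∎
        where
        open ≤-Reasoning
        avoids-block-u : ∀ g → usedOutside g i ≡ true → not ⌊ block u ≟ g ⌋ ≡ true
        avoids-block-u g used with usedOutside-witness used
        ... | u′ , u′∉g , cu′≡i = cong not (⌊⌋-false (block u ≟ g) u∉g)
          where
          u∉g : block u ≢ g
          u∉g u∈g = u′∉g (trans (colour-class-in-one-block (trans cu′≡i (sym cu≡i))) u∈g)

      end-seen : ∀ g i → colourSeen (KmPn m n) c (end g) i ≡ true →
                 usedOutside g i ≡ true ⊎ ⌊ c (next g) ≟ i ⌋ ≡ true
      end-seen g i seen with anyF-elim _ seen
      ... | u , p with block u ≟ g
      ...   | yes u∈g = inj₂ (subst (λ x → ⌊ c x ≟ i ⌋ ≡ true) (end-neighbour (∧-conicalˡ _ _ p) u∈g) (∧-conicalʳ _ _ p))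
      ...   | no u∉g = inj₁ (anyF-intro _ u (cong₂ _∧_ (cong not (⌊⌋-false (block u ≟ g) u∉g)) (∧-conicalʳ _ _ p)))

      end-bound : ∀ g → r ≤ countF (usedOutside g) + 1
      end-bound g = begin
        r                                            ≡⟨ sym (m≤n⇒m⊓n≡m (r≤deg (end g))) ⟩
        r ⊓ deg (KmPn m n) (end g)                   ≤⟨ proj₂ (proj₂ col) (end g) ⟩
        nbrColours (KmPn m n) c (end g)              ≤⟨ countF-∪ (end-seen g) ⟩
        countF (usedOutside g) + countF (λ i → ⌊ c (next g) ≟ i ⌋)
                                                     ≡⟨ cong (countF (usedOutside g) +_) (countF-point (c (next g))) ⟩
        countF (usedOutside g) + 1                   ∎
        where open ≤-Reasoning

      colours-lower-bound : m * r ≤ k * (m ∸ 1) + m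
      colours-lower-bound = begin
        m * r                                                    ≡⟨ sym (∑-const m r) ⟩
        ∑[ g < m ] r                                             ≤⟨ ∑-mono-≤ end-bound ⟩
        ∑[ g < m ] (countF (usedOutside g) + 1)                  ≡⟨ ∑-distrib-+ (countF ∘ usedOutside) (λ _ → 1) ⟩
        ∑[ g < m ] countF (usedOutside g) + ∑[ g < m ] 1
                                 ≡⟨ cong₂ _+_ (∑-countF-comm usedOutside) (trans (∑-const m 1) (*-identityʳ m)) ⟩
        ∑[ i < k ] countF (λ g → usedOutside g i) + m            ≤⟨ +-monoˡ-≤ m (∑-mono-≤ usedOutside-count) ⟩
        ∑[ i < k ] (m ∸ 1) + m                                   ≡⟨ cong (_+ m) (∑-const k (m ∸ 1)) ⟩
        k * (m ∸ 1) + m                                          ∎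
        where open ≤-Reasoning

    module LevelledColouring {{_ : NonZero m}} (k T : ℕ) (2m≤k : 2 * m ≤ k) (k≤Tm : k ≤ T * m) (T≤n : T ≤ n) where

      row : Fin m → ℕ → ℕ
      row g h with toℕ g + h * m <? k
      ... | yes _ = h
      ... | no _ = toℕ (parity h)

      code : Fin m → ℕ → ℕ
      code g h = toℕ g + row g h * m

      row-fits : ∀ g h → toℕ g + h * m < k → row g h ≡ h
      row-fits g h fits with toℕ g + h * m <? k
      ... | yes _ = refl
      ... | no ¬fits = contradiction fits ¬fits

      code<k : ∀ g h → code g h < k
      code<k g h with toℕ g + h * m <? k
      ... | yes fits = fits
      ... | no _ = ≤-trans (+-mono-<-≤ (toℕ<n g) (*-monoˡ-≤ m (≤-pred (toℕ<n (parity h))))) 2m≤k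

      code%m : ∀ g h → code g h % m ≡ toℕ g
      code%m g h = trans ([m+kn]%n≡m%n (toℕ g) (row g h) m) (m<n⇒m%n≡m (toℕ<n g))

      row-consecutive : ∀ g h → row g h ≢ row g (suc h)
      row-consecutive g h with toℕ g + h * m <? k | toℕ g + suc h * m <? k
      ... | yes _ | yes _ = λ eq → 1+n≢n (sym eq)
      ... | yes _ | no _ = h≢parity-suc h
      ... | no _ | no _ = λ eq → parity-suc h (sym (toℕ-injective eq))
      ... | no ¬fits | yes fits′ =
        contradiction (≤-<-trans (+-monoʳ-≤ (toℕ g) (*-monoˡ-≤ m (n≤1+n h))) fits′) ¬fits

      code-cancel : ∀ g {h h′} → code g h ≡ code g h′ → row g h ≡ row g h′
      code-cancel g eq = *-cancelʳ-≡ _ _ m (+-cancelˡ-≡ (toℕ g) _ _ eq)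

      code-path : ∀ g {h h′ : Fin n} → path n h h′ ≡ true → code g (toℕ h) ≢ code g (toℕ h′)
      code-path g {h} {h′} hh′ eq with path⇒consecutive h h′ hh′
      ... | inj₁ h′≡1+h = row-consecutive g (toℕ h) (subst (λ x → row g (toℕ h) ≡ row g x) h′≡1+h same-row)
        where same-row = code-cancel g eq
      ... | inj₂ h≡1+h′ = row-consecutive g (toℕ h′) (subst (λ x → row g (toℕ h′) ≡ row g x) h≡1+h′ same-row)
        where same-row = code-cancel g (sym eq)

      colour : V → Fin k
      colour u = fromℕ< (code<k (block u) (toℕ (level u)))

      toℕ-colour : ∀ u → toℕ (colour u) ≡ code (block u) (toℕ (level u))
      toℕ-colour u = toℕ-fromℕ< (code<k (block u) (toℕ (level u)))

      colour%m : ∀ u → toℕ (colour u) % m ≡ toℕ (block u)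
      colour%m u = trans (cong (_% m) (toℕ-colour u)) (code%m (block u) (toℕ (level u)))

      colour-proper : ∀ u v → KmPn m n u v ≡ true → colour u ≢ colour v
      colour-proper u v uv cu≡cv = code-path (block u) (adjacent-within⁻¹ uv same-block) same-code
        where
        same-block : block u ≡ block v
        same-block = toℕ-injective (trans (sym (colour%m u)) (trans (cong (λ i → toℕ i % m) cu≡cv) (colour%m v)))
        same-code : code (block u) (toℕ (level u)) ≡ code (block u) (toℕ (level v))
        same-code = trans (sym (toℕ-colour u)) (trans (cong toℕ cu≡cv)
                      (trans (toℕ-colour v) (cong (λ g → code g (toℕ (level v))) (sym same-block))))

      colour-vertex : ∀ g h → toℕ (colour (vertex g h)) ≡ code g (toℕ h)
      colour-vertex g h rewrite toℕ-colour (vertex g h) | block-vertex g h | level-vertex g h = refl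

      residue : Fin k → Fin m
      residue i = fromℕ< (m%n<n (toℕ i) m)

      quotient-index : Fin k → Fin T
      quotient-index i = fromℕ< (m<n*o⇒m/o<n (≤-trans (toℕ<n i) k≤Tm))

      quotient-index-injective : ∀ {i i′} → toℕ i % m ≡ toℕ i′ % m → quotient-index i ≡ quotient-index i′ → i ≡ i′
      quotient-index-injective same-residue same-quotient = toℕ-injective (%-/-injective m same-residue
        (trans (sym (toℕ-fromℕ< _)) (trans (cong toℕ same-quotient) (toℕ-fromℕ< _))))

      realise : Fin k → V
      realise i = vertex (residue i) (inject≤ (quotient-index i) T≤n)

      colour-realise : ∀ i → colour (realise i) ≡ i
      colour-realise i = toℕ-injective (begin
        toℕ (colour (realise i))             ≡⟨ colour-vertex (residue i) (inject≤ (quotient-index i) T≤n) ⟩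
        code (residue i) (toℕ (inject≤ (quotient-index i) T≤n))
                                             ≡⟨ cong (code (residue i)) (trans (toℕ-inject≤ _ T≤n) (toℕ-fromℕ< _)) ⟩
        code (residue i) (toℕ i / m)         ≡⟨ cong (λ x → toℕ (residue i) + x * m) (row-fits _ _ fits) ⟩
        toℕ (residue i) + toℕ i / m * m      ≡⟨ divMod ⟩
        toℕ i                                ∎)
        where
        open ≡-Reasoning
        divMod : toℕ (residue i) + toℕ i / m * m ≡ toℕ i
        divMod = trans (cong (_+ toℕ i / m * m) (toℕ-fromℕ< _)) (sym (m≡m%n+[m/n]*n (toℕ i) m))
        fits : toℕ (residue i) + toℕ i / m * m < k
        fits = subst (_< k) (sym divMod) (toℕ<n i)

      module _ (v : V) where

        private
          h′ = proj₁ (path-neighbour 1<n (level v))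
          w = vertex (block v) h′

          vw : KmPn m n v w ≡ true
          vw = adjacent-to-vertex-within (proj₂ (path-neighbour 1<n (level v)))

          colour-w%m : toℕ (colour w) % m ≡ toℕ (block v)
          colour-w%m = trans (colour%m w) (cong toℕ (block-vertex (block v) h′))

        possiblyUnseen : Fin k → Bool
        possiblyUnseen i = ⌊ toℕ i % m ℕ.≟ toℕ (block v) ⌋ ∧ not ⌊ colour w ≟ i ⌋

        seen-unless-possiblyUnseen : ∀ i → possiblyUnseen i ≡ false → colourSeen (KmPn m n) colour v i ≡ true
        seen-unless-possiblyUnseen i unseen with toℕ i % m ℕ.≟ toℕ (block v)
        ... | no other-block = colourSeen-intro (KmPn m n) colour
          (adjacent-to-vertex-across (inject≤ (quotient-index i) T≤n)
            (λ eq → other-block (trans (sym (toℕ-fromℕ< (m%n<n (toℕ i) m))) (cong toℕ (sym eq)))))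
          (colour-realise i)
        ... | yes _ = colourSeen-intro (KmPn m n) colour vw (⌊⌋-true⁻¹ (colour w ≟ i) (not-false unseen))

        possiblyUnseen-count : countF possiblyUnseen ≤ T ∸ 1
        possiblyUnseen-count = begin
          countF possiblyUnseen                                 ≤⟨ countF-injection quotient-index avoids-w injective ⟩
          countF (λ j → not ⌊ quotient-index (colour w) ≟ j ⌋)  ≡⟨ countF-≢ (quotient-index (colour w)) ⟩
          T ∸ 1                                                 ∎
          where
          open ≤-Reasoning
          residue≡ : ∀ {i} → possiblyUnseen i ≡ true → toℕ i % m ≡ toℕ (block v)
          residue≡ {i} p = ⌊⌋-true⁻¹ (toℕ i % m ℕ.≟ toℕ (block v)) (∧-conicalˡ _ _ p)
          avoids-w : ∀ i → possiblyUnseen i ≡ true → not ⌊ quotient-index (colour w) ≟ quotient-index i ⌋ ≡ true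
          avoids-w i p = cong not (⌊⌋-false (quotient-index (colour w) ≟ quotient-index i) λ same-quotient →
            ⌊⌋-false⁻¹ (colour w ≟ i) (not-true (∧-conicalʳ _ _ p))
              (quotient-index-injective (trans colour-w%m (sym (residue≡ p))) same-quotient))
          injective : ∀ i i′ → possiblyUnseen i ≡ true → possiblyUnseen i′ ≡ true →
                      quotient-index i ≡ quotient-index i′ → i ≡ i′
          injective i i′ p p′ = quotient-index-injective (trans (residue≡ p) (sym (residue≡ p′)))

        levelled-dynamic : k ∸ (T ∸ 1) ≤ nbrColours (KmPn m n) colour v
        levelled-dynamic = ≤-trans (∸-monoʳ-≤ k possiblyUnseen-count) (countF-≥-∸ seen-unless-possiblyUnseen)

      levelled-colouring : HasDynamicColouring (k ∸ (T ∸ 1)) k (KmPn m n)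
      levelled-colouring = colour , colour-proper , λ v → ≤-trans (m⊓n≤m _ _) (levelled-dynamic v)


chi-middle : ∀ D n r .{{_ : NonZero D}} → 1 < n → 2 * suc D ≤ r → (∀ v → r ≤ deg (KmPn (suc D) n) v) →
             ChiR≡ r (KmPn (suc D) n) (r + 2 + (r ∸ 2 * suc D) / D)
chi-middle D n r 1<n 2[1+D]≤r r≤deg =
  subst (λ x → HasDynamicColouring x (r + 2 + q) (KmPn (suc D) n)) excess-cancel levelled-colouring
  , λ k′ col → colours-needed k′ (colours-lower-bound 1<n r≤deg col)
  where
  open KmPnProperties (suc D) n
  open Excess D r 2[1+D]≤r
  2[1+D]≤k : 2 * suc D ≤ r + 2 + q
  2[1+D]≤k = ≤-trans 2[1+D]≤r (≤-trans (m≤m+n r 2) (m≤m+n (r + 2) q))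
  row-bound : r + (n ∸ 1) ≤ suc D * n
  row-bound = ≤-trans (+-monoˡ-≤ (n ∸ 1) (r≤deg (end 1<n zero))) (end-degree 1<n zero)
  open LevelledColouring 1<n (r + 2 + q) (3 + q) 2[1+D]≤k colours-fit (rows-fit n row-bound)

theorem5 : (r m n : ℕ) → 1 ≤ r → 3 ≤ m → 3 ≤ n →
    (δ Δ : ℕ) → IsMinDegree (KmPn m n) δ → IsMaxDegree (KmPn m n) Δ →
      ((r ≤ 2 * m ∸ 1 → ChiR≡ r (KmPn m n) (2 * m))
      × (2 * m ≤ r → r ≤ δ →
           ChiR≡ r (KmPn m n) (r + 2 + ((r ∸ 2 * m) div′ (m ∸ 1))))
      × (Δ ≤ r → ChiR≡ r (KmPn m n) (m * n)))
theorem5 r m n _ (s≤s (s≤s (s≤s {n = a} _))) 3≤n δ Δ (_ , δ≤deg) (_ , deg≤Δ) =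
    chi-small 1<n
  , (λ 2m≤r r≤δ → chi-middle (suc (suc a)) n r 1<n 2m≤r (λ v → ≤-trans r≤δ (δ≤deg v)))
  , (λ Δ≤r → chi-large (s≤s (s≤s z≤n)) (λ v → ≤-trans (deg≤Δ v) Δ≤r))
  where
  open KmPnProperties m n
  1<n : 1 < n
  1<n = ≤-trans (s≤s (s≤s z≤n)) 3≤n
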